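{- If $n_1\cdots n_d$ is odd, then the nim-value of $\text{TER}(\Gamma)$ is nonzero (the first player wins).
   Context: $\Gamma=P_{n_1}\Box\cdots\Box P_{n_d}$ is a lattice graph ($P_k$ the path on $k$ vertices, $2\le n_1\le\cdots\le n_d$, $n_d\ge3$). A vertex set is (geodetically) convex if it contains every vertex on every shortest path between two of its vertices; $[S]$ denotes the convex hull. In the removing game $\text{TER}(\Gamma)$ with vertex set $V$, two players alternately select previously unselected vertices (position = set $P$ of selected vertices), and the game ends as soon as $[V\setminus P]\ne V$. The last player to move wins (normal play); the nim-value is the Sprague–Grundy value of the starting position. -}

module Defs where

open import Level using (Level) renaming (suc to lsuc; zero to lzero)
open import Data.Nat using (ℕ; zero; suc; _+_; _*_; _≤_; _<_)
open import Data.Nat.Properties using () renaming (_≟_ to _≟ℕ_)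
open import Data.Bool using (Bool; true; false; _∨_)
open import Data.Fin using (Fin)
open import Data.Vec using (Vec; lookup; foldr)
open import Data.Vec.Properties using (≡-dec)
open import Data.Product using (Σ; _×_; _,_)
open import Data.Sum using (_⊎_)
open import Relation.Nullary using (¬_)
open import Relation.Nullary.Decidable using (⌊_⌋)
open import Relation.Binary.PropositionalEquality using (_≡_; _≢_)

prodV : ∀ {d} → Vec ℕ d → ℕ
prodV = foldr _ _*_ 1

module Lattice {d : ℕ} (n : Vec ℕ d) where

  -- Vertices of Γ = P_{n_1} □ ... □ P_{n_d}: vectors x with 0 ≤ x_i < n_i.
  -- (We work on the ambient type Vec ℕ d and restrict via Vert.)
  Pt : Set
  Pt = Vec ℕ d

  Vert : Pt → Set
  Vert x = ∀ (i : Fin d) → lookup x i < lookup n i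

  PathAdj : ℕ → ℕ → Set
  PathAdj a b = suc a ≡ b ⊎ suc b ≡ a

  Adj : Pt → Pt → Set
  Adj x y = Vert x × Vert y × Σ (Fin d) λ i →
              PathAdj (lookup x i) (lookup y i) ×
              (∀ j → j ≢ i → lookup x j ≡ lookup y j)

  data Walk : Pt → Pt → ℕ → Set where
    [] : ∀ {x} → Vert x → Walk x x 0
    _∷_ : ∀ {x y z k} → Adj x y → Walk y z k → Walk x z (suc k)

  OnGeodesic : Pt → Pt → Pt → Set
  OnGeodesic x y z = Σ ℕ λ a → Σ ℕ λ b →
    Walk x z a × Walk z y b × (∀ m → Walk x y m → a + b ≤ m)

  Convex : (Pt → Set) → Set
  Convex C = ∀ x y z → C x → C y → OnGeodesic x y z → C z

  Hull : (Pt → Set) → Pt → Set₁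
  Hull S z = Vert z × (∀ (C : Pt → Set) → (∀ x → C x → Vert x) → Convex C →
               (∀ x → S x → C x) → C z)

  -- positions: sets of selected vertices (characteristic functions)
  Pos : Set
  Pos = Pt → Bool

  start : Pos
  start _ = false

  Unselected : Pos → Pt → Set
  Unselected P x = Vert x × P x ≡ false

  NotEnded : Pos → Set₁
  NotEnded P = ∀ z → Vert z → Hull (Unselected P) z

  Move : Pos → Pos → Set₁
  Move P Q = NotEnded P × Σ Pt λ v → Vert v × P v ≡ false ×
               (∀ w → Q w ≡ (P w ∨ ⌊ ≡-dec _≟ℕ_ w v ⌋))

  data Grundy : Pos → ℕ → Set₁ where
    mex : ∀ {P g} →
          (∀ Q → Move P Q → Σ ℕ λ h → Grundy Q h × h ≢ g) →
          (∀ k → k < g → Σ Pos λ Q → Move P Q × Grundy Q k) →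
          Grundy P g

  NimValue : ℕ → Set₁
  NimValue g = Grundy start g

{-# OPTIONS --safe #-}
module Submission where

-- Geodesics of the grid are exactly the lattice points of the bounding box of their ends. Hence a
-- set of vertices has the whole grid as convex hull iff it meets every face {x_i = 0} and
-- {x_i = n_i - 1} (coordinatewise minima and maxima of its points then span the grid), and the game
-- ends exactly when some face has been completely selected.
-- On a path the first player wins at once by taking an endpoint. In dimension at least two, with
-- all n_i odd, the first player takes the centre and answers each move v by its reflection through
-- the centre, unless v leaves a single unselected vertex on some face, which is then taken to end
-- the game. So positions that are centrally symmetric, contain the centre and keep two unselected
-- vertices on every face have Grundy value 0, and taking the centre first leads to one of them.

open import Defs
open import Algebra.Bundles using (CommutativeMonoid)
open import Data.Bool as Bool using (true; false; _∨_)
open import Data.Bool.Properties using (∨-zeroʳ; ∨-identityʳ; ∨-commutativeMonoid)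
open import Data.Empty using (⊥; ⊥-elim)
open import Data.Fin using (Fin; zero; suc; toℕ; fromℕ; fromℕ<)
open import Data.Fin.Properties as Finₚ
  using (all?; ¬∀⟶∃¬; ¬∀⟶∃¬-smallest; toℕ-inject; toℕ-fromℕ<; toℕ-fromℕ)
open import Data.List as List using (List; []; _∷_; upTo; cartesianProductWith; allFin; filter; length)
open import Data.List.Properties using (filter-notAll)
open import Data.List.Membership.Propositional using (_∈_; _∉_; lose; mapWith∈)
open import Data.List.Membership.Propositional.Properties
  using (∈-cartesianProductWith⁺; ∈-upTo⁺; ∈-allFin; ∈-filter⁺; ∈-filter⁻; ∈-map⁺; ∈-map⁻)
open import Data.List.Relation.Unary.Any as Any using (here; there; any?; satisfied)
open import Data.List.Relation.Unary.Any.Properties using (mapWith∈⁺)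
open import Data.Nat
open import Data.Nat.DivMod using (m%n<n; %-distribˡ-*; m≡m%n+[m/n]*n)
open import Data.Nat.Induction using (<-wellFounded)
open import Data.Nat.ListAction using (sum)
open import Data.Nat.Properties
open import Data.List.Membership.DecPropositional _≟_ using (_∈?_)
open import Data.Product using (Σ; ∃; ∃-syntax; _×_; _,_; proj₁; proj₂)
open import Data.Sum using (_⊎_; inj₁; inj₂; [_,_])
open import Data.Vec using (Vec; []; _∷_; lookup; _[_]≔_; replicate; map; zipWith; tabulate)
open import Data.Vec.Properties
  using (≡-dec; lookup∘update; lookup∘update′; lookup-replicate; lookup-map; lookup-zipWith; lookup∘tabulate)
open import Data.Vec.Relation.Binary.Pointwise.Extensional using (ext; Pointwise-≡⇒≡)
open import Function using (_∘_; _on_)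
open import Function.Bundles using (mk⇔)
open import Induction.WellFounded using (Acc; acc)
open import Relation.Binary.Construct.On as On using ()
open import Relation.Binary.Definitions using (DecidableEquality; tri<; tri≈; tri>)
open import Relation.Binary.PropositionalEquality hiding ([_])
open import Relation.Nullary using (¬_; ¬?; Dec; yes; no; contradiction; _×-dec_)
open import Relation.Nullary.Decidable using (⌊_⌋; isYes≗does; does-⇔)

open import Algebra.Properties.CommutativeSemigroup +-commutativeSemigroup using (interchange)
open import Algebra.Properties.CommutativeSemigroup (CommutativeMonoid.commutativeSemigroup ∨-commutativeMonoid)
  using (xy∙z≈xz∙y)

-- Betweenness and the ℓ¹ distance

Between : ℕ → ℕ → ℕ → Set
Between a b c = a ⊓ b ≤ c × c ≤ a ⊔ b

between-left : ∀ a b → Between a b a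
between-left a b = m⊓n≤m a b , m≤m⊔n a b

between⇒∣-∣-additive : ∀ a b c → Between a b c → ∣ a - c ∣ + ∣ c - b ∣ ≡ ∣ a - b ∣
between⇒∣-∣-additive zero b c (_ , c≤b) = begin
  c + ∣ c - b ∣ ≡⟨ cong (c +_) (m≤n⇒∣m-n∣≡n∸m c≤b) ⟩
  c + (b ∸ c)   ≡⟨ m+[n∸m]≡n c≤b ⟩
  b             ∎
  where open ≡-Reasoning
between⇒∣-∣-additive (suc a) zero c (_ , c≤a) = begin
  ∣ suc a - c ∣ + ∣ c - 0 ∣ ≡⟨ cong₂ _+_ (m≤n⇒∣n-m∣≡n∸m c≤a) (∣-∣-identityʳ c) ⟩
  (suc a ∸ c) + c         ≡⟨ m∸n+n≡m c≤a ⟩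
  suc a                   ∎
  where open ≡-Reasoning
between⇒∣-∣-additive (suc a) (suc b) zero (() , _)
between⇒∣-∣-additive (suc a) (suc b) (suc c) (s≤s l , s≤s u) = between⇒∣-∣-additive a b c (l , u)

∣-∣-additive⇒between : ∀ a b c → ∣ a - c ∣ + ∣ c - b ∣ ≤ ∣ a - b ∣ → Between a b c
∣-∣-additive⇒between zero b c h = z≤n , ≤-trans (m≤m+n c _) h
∣-∣-additive⇒between (suc a) zero c h =
  z≤n , ≤-trans (m≤n+m c _) (subst (λ t → ∣ suc a - c ∣ + t ≤ suc a) (∣-∣-identityʳ c) h)
∣-∣-additive⇒between (suc a) (suc b) zero h =
  contradiction h (<⇒≱ (≤-<-trans (≤-trans (∣m-n∣≤m⊔n a b) (m⊔n≤m+n a b)) (+-mono-< (n<1+n a) (n<1+n b))))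
∣-∣-additive⇒between (suc a) (suc b) (suc c) h
  with l , u ← ∣-∣-additive⇒between a b c h = s≤s l , s≤s u

step-towardℕ : ∀ {a b} → a ≢ b → ∃[ c ] (suc a ≡ c ⊎ suc c ≡ a) × Between a b c
step-towardℕ {a} {b} a≢b with <-cmp a b
... | tri< a<b _ _ = suc a , inj₁ refl , ≤-trans (m⊓n≤m a b) (n≤1+n a) , ≤-trans a<b (m≤n⊔m a b)
... | tri≈ _ a≡b _ = contradiction a≡b a≢b
step-towardℕ {suc a} {b} _ | tri> _ _ (s≤s b≤a) =
  a , inj₂ refl , ≤-trans (m⊓n≤n (suc a) b) b≤a , ≤-trans (n≤1+n a) (m≤m⊔n (suc a) b)

lookup-ext : ∀ {k} (x y : Vec ℕ k) → (∀ i → lookup x i ≡ lookup y i) → x ≡ y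
lookup-ext x y x≗y = Pointwise-≡⇒≡ {xs = x} {y} (ext x≗y)

dist : ∀ {k} → Vec ℕ k → Vec ℕ k → ℕ
dist [] [] = 0
dist (a ∷ x) (b ∷ y) = ∣ a - b ∣ + dist x y

dist-self : ∀ {k} (x : Vec ℕ k) → dist x x ≡ 0
dist-self [] = refl
dist-self (a ∷ x) = cong₂ _+_ (∣n-n∣≡0 a) (dist-self x)

dist-triangle : ∀ {k} (x y z : Vec ℕ k) → dist x z ≤ dist x y + dist y z
dist-triangle [] [] [] = z≤n
dist-triangle (a ∷ x) (b ∷ y) (c ∷ z) = begin
  ∣ a - c ∣ + dist x z                               ≤⟨ +-mono-≤ (∣-∣-triangle a b c) (dist-triangle x y z) ⟩
  (∣ a - b ∣ + ∣ b - c ∣) + (dist x y + dist y z)    ≡⟨ interchange ∣ a - b ∣ ∣ b - c ∣ (dist x y) (dist y z) ⟩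
  (∣ a - b ∣ + dist x y) + (∣ b - c ∣ + dist y z)    ∎
  where open ≤-Reasoning

dist-single-coordinate : ∀ {k} (x y : Vec ℕ k) i → (∀ j → j ≢ i → lookup x j ≡ lookup y j) →
                         dist x y ≡ ∣ lookup x i - lookup y i ∣
dist-single-coordinate (a ∷ x) (b ∷ y) zero agree =
  trans (cong (∣ a - b ∣ +_) (trans (cong (λ t → dist t y) x≡y) (dist-self y))) (+-identityʳ _)
  where x≡y = lookup-ext x y λ j → agree (suc j) λ ()
dist-single-coordinate (a ∷ x) (b ∷ y) (suc i) agree =
  cong₂ _+_ (m≡n⇒∣m-n∣≡0 (agree zero λ ()))
            (dist-single-coordinate x y i λ j j≢i → agree (suc j) (j≢i ∘ Finₚ.suc-injective))

dist≡0⇒≡ : ∀ {k} (x y : Vec ℕ k) → dist x y ≡ 0 → x ≡ y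
dist≡0⇒≡ [] [] _ = refl
dist≡0⇒≡ (a ∷ x) (b ∷ y) d≡0 = cong₂ _∷_ (∣m-n∣≡0⇒m≡n (m+n≡0⇒m≡0 _ d≡0)) (dist≡0⇒≡ x y (m+n≡0⇒n≡0 _ d≡0))

dist≢0⇒∃-coordinate≢ : ∀ {k} (x y : Vec ℕ k) → dist x y ≢ 0 → ∃[ i ] lookup x i ≢ lookup y i
dist≢0⇒∃-coordinate≢ x y d≢0 = ¬∀⟶∃¬ _ _ (λ i → lookup x i ≟ lookup y i) λ x≗y →
  d≢0 (trans (cong (λ t → dist t y) (lookup-ext x y x≗y)) (dist-self y))

InBox : ∀ {k} → Vec ℕ k → Vec ℕ k → Vec ℕ k → Set
InBox x y z = ∀ i → Between (lookup x i) (lookup y i) (lookup z i)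

inBox⇒dist-additive : ∀ {k} (x y z : Vec ℕ k) → InBox x y z → dist x z + dist z y ≡ dist x y
inBox⇒dist-additive [] [] [] _ = refl
inBox⇒dist-additive (a ∷ x) (b ∷ y) (c ∷ z) box = begin
  (∣ a - c ∣ + dist x z) + (∣ c - b ∣ + dist z y) ≡⟨ interchange ∣ a - c ∣ (dist x z) ∣ c - b ∣ (dist z y) ⟩
  (∣ a - c ∣ + ∣ c - b ∣) + (dist x z + dist z y) ≡⟨ cong₂ _+_ (between⇒∣-∣-additive a b c (box zero))
                                                               (inBox⇒dist-additive x y z (box ∘ suc)) ⟩
  ∣ a - b ∣ + dist x y                            ∎
  where open ≡-Reasoning

+-≤-parts : ∀ {m n o p} → o ≤ m → p ≤ n → m + n ≤ o + p → m ≤ o × n ≤ p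
+-≤-parts {m} {n} {o} {p} o≤m p≤n h =
  +-cancelʳ-≤ n m o (≤-trans h (+-monoʳ-≤ o p≤n)) , +-cancelˡ-≤ m n p (≤-trans h (+-monoˡ-≤ p o≤m))

dist-additive-split : ∀ {k} a b c (x y z : Vec ℕ k) →
  dist (a ∷ x) (c ∷ z) + dist (c ∷ z) (b ∷ y) ≤ dist (a ∷ x) (b ∷ y) →
  ∣ a - c ∣ + ∣ c - b ∣ ≤ ∣ a - b ∣ × dist x z + dist z y ≤ dist x y
dist-additive-split a b c x y z h = +-≤-parts (∣-∣-triangle a c b) (dist-triangle x z y)
  (≤-trans (≤-reflexive (sym (interchange ∣ a - c ∣ (dist x z) ∣ c - b ∣ (dist z y)))) h)

dist-additive⇒inBox : ∀ {k} (x y z : Vec ℕ k) → dist x z + dist z y ≤ dist x y → InBox x y z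
dist-additive⇒inBox (a ∷ x) (b ∷ y) (c ∷ z) h zero =
  ∣-∣-additive⇒between a b c (proj₁ (dist-additive-split a b c x y z h))
dist-additive⇒inBox (a ∷ x) (b ∷ y) (c ∷ z) h (suc i) =
  dist-additive⇒inBox x y z (proj₂ (dist-additive-split a b c x y z h)) i

vectorsBelow : ∀ {k} → Vec ℕ k → List (Vec ℕ k)
vectorsBelow [] = [] ∷ []
vectorsBelow (m ∷ n) = cartesianProductWith _∷_ (upTo m) (vectorsBelow n)

∈-vectorsBelow : ∀ {k} (n x : Vec ℕ k) → (∀ i → lookup x i < lookup n i) → x ∈ vectorsBelow n
∈-vectorsBelow [] [] _ = here refl
∈-vectorsBelow (m ∷ n) (a ∷ x) below =
  ∈-cartesianProductWith⁺ _∷_ (∈-upTo⁺ (below zero)) (∈-vectorsBelow n x (below ∘ suc))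

-- Geodesics of the grid

∣1+n-n∣≡1 : ∀ a → ∣ suc a - a ∣ ≡ 1
∣1+n-n∣≡1 a = trans (m≤n⇒∣n-m∣≡n∸m (n≤1+n a)) (m+n∸n≡m 1 a)

module Geodesics {k} (n : Vec ℕ k) where
  open Lattice n

  pathAdj⇒∣-∣≡1 : ∀ {a b} → PathAdj a b → ∣ a - b ∣ ≡ 1
  pathAdj⇒∣-∣≡1 {a} (inj₁ refl) = trans (∣-∣-comm a (suc a)) (∣1+n-n∣≡1 a)
  pathAdj⇒∣-∣≡1 {b = b} (inj₂ refl) = ∣1+n-n∣≡1 b

  adj⇒dist≡1 : ∀ x y → Adj x y → dist x y ≡ 1
  adj⇒dist≡1 x y (_ , _ , i , adjᵢ , agree) = trans (dist-single-coordinate x y i agree) (pathAdj⇒∣-∣≡1 adjᵢ)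

  walk⇒dist≤ : ∀ {x y m} → Walk x y m → dist x y ≤ m
  walk⇒dist≤ {x} ([] _) = ≤-reflexive (dist-self x)
  walk⇒dist≤ {x} {z} (_∷_ {y = y} {k = m} adj w) = begin
    dist x z            ≤⟨ dist-triangle x y z ⟩
    dist x y + dist y z ≡⟨ cong (_+ dist y z) (adj⇒dist≡1 x y adj) ⟩
    suc (dist y z)      ≤⟨ s≤s (walk⇒dist≤ w) ⟩
    suc m               ∎
    where open ≤-Reasoning

  inBox⇒vert : ∀ x y z → Vert x → Vert y → InBox x y z → Vert z
  inBox⇒vert x y z vx vy box i = ≤-<-trans (proj₂ (box i)) (⊔-pres-<m (vx i) (vy i))

  step-toward : ∀ x y {m} → Vert x → Vert y → dist x y ≡ suc m → ∃[ x′ ] Adj x x′ × dist x′ y ≡ m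
  step-toward x y {m} vx vy d≡1+m
    with i , xᵢ≢yᵢ ← dist≢0⇒∃-coordinate≢ x y (λ d≡0 → 0≢1+n (trans (sym d≡0) d≡1+m))
    with c , adjᵢ , betweenᵢ ← step-towardℕ xᵢ≢yᵢ
    = x′ , adj , dist-rest
    where
      x′ = x [ i ]≔ c
      agree : ∀ j → j ≢ i → lookup x j ≡ lookup x′ j
      agree j j≢i = sym (lookup∘update′ j≢i x c)
      box : InBox x y x′
      box j with j Finₚ.≟ i
      ... | yes refl = subst (Between _ _) (sym (lookup∘update i x c)) betweenᵢ
      ... | no j≢i = subst (Between _ _) (agree j j≢i) (between-left _ _)
      adj : Adj x x′
      adj = vx , inBox⇒vert x y x′ vx vy box , i , subst (PathAdj _) (sym (lookup∘update i x c)) adjᵢ , agree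
      dist-rest : dist x′ y ≡ m
      dist-rest = suc-injective (begin
        suc (dist x′ y)       ≡⟨ cong (_+ dist x′ y) (adj⇒dist≡1 x x′ adj) ⟨
        dist x x′ + dist x′ y ≡⟨ inBox⇒dist-additive x y x′ box ⟩
        dist x y              ≡⟨ d≡1+m ⟩
        suc m                 ∎)
        where open ≡-Reasoning

  walk-of-dist : ∀ x y m → Vert x → Vert y → dist x y ≡ m → Walk x y m
  walk-of-dist x y zero vx vy d≡0 = subst (λ t → Walk x t 0) (dist≡0⇒≡ x y d≡0) ([] vx)
  walk-of-dist x y (suc m) vx vy d≡1+m with x′ , adj , d′ ← step-toward x y vx vy d≡1+m =
    adj ∷ walk-of-dist x′ y m (proj₁ (proj₂ adj)) vy d′

  onGeodesic⇒inBox : ∀ x y z → Vert x → Vert y → OnGeodesic x y z → InBox x y z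
  onGeodesic⇒inBox x y z vx vy (a , b , xz , zy , shortest) = dist-additive⇒inBox x y z (begin
    dist x z + dist z y ≤⟨ +-mono-≤ (walk⇒dist≤ xz) (walk⇒dist≤ zy) ⟩
    a + b               ≤⟨ shortest _ (walk-of-dist x y _ vx vy refl) ⟩
    dist x y            ∎)
    where open ≤-Reasoning

  inBox⇒onGeodesic : ∀ x y z → Vert x → Vert y → InBox x y z → OnGeodesic x y z
  inBox⇒onGeodesic x y z vx vy box =
    dist x z , dist z y , walk-of-dist x z _ vx vz refl , walk-of-dist z y _ vz vy refl ,
    λ m w → ≤-trans (≤-reflexive (inBox⇒dist-additive x y z box)) (walk⇒dist≤ w)
    where vz = inBox⇒vert x y z vx vy box

  convex⇒inBox-closed : ∀ {C x y z} → Convex C → (∀ x → C x → Vert x) → C x → C y → InBox x y z → C z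
  convex⇒inBox-closed {x = x} {y} {z} convex C⊆V cx cy box =
    convex x y z cx cy (inBox⇒onGeodesic x y z (C⊆V x cx) (C⊆V y cy) box)

-- Faces, and when the game ends

data Side : Set where
  lo hi : Side

flip : Side → Side
flip lo = hi
flip hi = lo

flip-involutive : ∀ s → flip (flip s) ≡ s
flip-involutive lo = refl
flip-involutive hi = refl

Extreme : ℕ → Side → ℕ → Set
Extreme m lo a = a ≡ 0
Extreme m hi a = suc a ≡ m

extreme? : ∀ m s a → Dec (Extreme m s a)
extreme? m lo a = a ≟ 0
extreme? m hi a = suc a ≟ m

between-extreme : ∀ {m} s {a b c} → a < m → b < m → Between a b c →
                  Extreme m s c → ¬ Extreme m s a → ¬ Extreme m s b → ⊥
between-extreme lo _ _ (a⊓b≤c , _) refl a≢0 b≢0 =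
  contradiction a⊓b≤c (<⇒≱ (⊓-glb (n≢0⇒n>0 a≢0) (n≢0⇒n>0 b≢0)))
between-extreme hi a<m b<m (_ , c≤a⊔b) refl ¬ea ¬eb =
  contradiction c≤a⊔b (<⇒≱ (⊔-pres-<m (below a<m ¬ea) (below b<m ¬eb)))
  where
    below : ∀ {a c} → a < suc c → suc a ≢ suc c → a < c
    below a<1+c a≢c = s≤s⁻¹ (≤∧≢⇒< a<1+c a≢c)

pull : Side → ℕ → ℕ → ℕ
pull lo = _⊓_
pull hi = _⊔_

pull-comm : ∀ s a b → pull s a b ≡ pull s b a
pull-comm lo = ⊓-comm
pull-comm hi = ⊔-comm

between-pull : ∀ s a b → Between a b (pull s a b)
between-pull lo a b = ≤-refl , m⊓n≤m⊔n a b
between-pull hi a b = m⊓n≤m⊔n a b , ≤-refl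

extreme-pullˡ : ∀ {m} s {a b} → b < m → Extreme m s a → Extreme m s (pull s a b)
extreme-pullˡ lo _ refl = refl
extreme-pullˡ hi b<1+a refl = cong suc (m≥n⇒m⊔n≡m (s≤s⁻¹ b<1+a))

extreme-pullʳ : ∀ {m} s {a b} → a < m → Extreme m s b → Extreme m s (pull s a b)
extreme-pullʳ s {a} {b} a<m eb = subst (Extreme _ s) (pull-comm s b a) (extreme-pullˡ s a<m eb)

extremes-span : ∀ {m a b c} → Extreme m lo a → Extreme m hi b → c < m → Between a b c
extremes-span refl refl (s≤s c≤b) = z≤n , c≤b

everyFace-or-counterexample : ∀ {k} {Q : Fin k → Side → Set} → (∀ i s → Dec (Q i s)) →
                              (∀ i s → Q i s) ⊎ ∃[ i ] ∃[ s ] ¬ Q i s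
everyFace-or-counterexample {Q = Q} Q? with all? (λ i → Q? i lo ×-dec Q? i hi)
... | yes both = inj₁ λ { i lo → proj₁ (both i) ; i hi → proj₂ (both i) }
... | no ¬both with i , ¬bothᵢ ← ¬∀⟶∃¬ _ _ (λ i → Q? i lo ×-dec Q? i hi) ¬both with Q? i lo
...   | no ¬lo = inj₂ (i , lo , ¬lo)
...   | yes qlo = inj₂ (i , hi , λ qhi → ¬bothᵢ (qlo , qhi))

module Faces {d} (n : Vec ℕ (suc d)) (n>0 : ∀ i → 0 < lookup n i) where
  open Lattice n
  open Geodesics n

  InFace : Fin (suc d) → Side → Pt → Set
  InFace i s x = Extreme (lookup n i) s (lookup x i)

  inFace? : ∀ i s x → Dec (InFace i s x)
  inFace? i s x = extreme? (lookup n i) s (lookup x i)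

  corner : Side → Pt
  corner lo = replicate _ 0
  corner hi = map pred n

  suc-pred-n : ∀ i → suc (pred (lookup n i)) ≡ lookup n i
  suc-pred-n i = suc-pred (lookup n i) {{>-nonZero (n>0 i)}}

  corner-vert : ∀ s → Vert (corner s)
  corner-vert lo i = subst (_< lookup n i) (sym (lookup-replicate i 0)) (n>0 i)
  corner-vert hi i = subst (_< lookup n i) (sym (lookup-map i pred n)) (≤-reflexive (suc-pred-n i))

  corner-inFace : ∀ i s → InFace i s (corner s)
  corner-inFace i lo = lookup-replicate i 0
  corner-inFace i hi = trans (cong suc (lookup-map i pred n)) (suc-pred-n i)

  SomeUnselectedOn : Pos → Fin (suc d) → Side → Set
  SomeUnselectedOn P i s = ∃[ x ] Unselected P x × InFace i s x

  inBox-inFace : ∀ {i s} x y z → Vert x → Vert y → InBox x y z →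
                 InFace i s z → InFace i s x ⊎ InFace i s y
  inBox-inFace {i} {s} x y z vx vy box fz with inFace? i s x | inFace? i s y
  ... | yes fx | _ = inj₁ fx
  ... | no _ | yes fy = inj₂ fy
  ... | no ¬fx | no ¬fy = ⊥-elim (between-extreme s (vx i) (vy i) (box i) fz ¬fx ¬fy)

  -- A geodesic meets a face only if one of its ends does, so the vertices off the face, together
  -- with the face itself when it still has an unselected vertex, form a convex set containing V ∖ P.
  notEnded⇒someUnselectedOn : ∀ {P} → NotEnded P → ∀ i s → SomeUnselectedOn P i s
  notEnded⇒someUnselectedOn {P} notEnded i s =
    proj₂ (proj₂ (notEnded (corner s) (corner-vert s)) Reaches (λ _ → proj₁) reaches-convex unselected-reaches)
      (corner-inFace i s)
    where
      Reaches : Pt → Set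
      Reaches x = Vert x × (InFace i s x → SomeUnselectedOn P i s)
      unselected-reaches : ∀ x → Unselected P x → Reaches x
      unselected-reaches x ux = proj₁ ux , λ fx → x , ux , fx
      reaches-convex : Convex Reaches
      reaches-convex x y z (vx , rx) (vy , ry) geo =
        inBox⇒vert x y z vx vy box , λ fz → [ rx , ry ] (inBox-inFace x y z vx vy box fz)
        where box = onGeodesic⇒inBox x y z vx vy geo

  -- Coordinatewise minima (maxima) with unselected vertices on the faces x_j = 0 (x_j = n_j - 1)
  -- stay in C and end on all these faces at once; every vertex lies in the box of the two results.
  module _ {P : Pos} (hit : ∀ i s → SomeUnselectedOn P i s)
           {C : Pt → Set} (C⊆V : ∀ x → C x → Vert x) (convex : Convex C)
           (unselected⊆C : ∀ x → Unselected P x → C x) where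

    pull-closed : ∀ s {x y} → C x → C y → C (zipWith (pull s) x y)
    pull-closed s {x} {y} cx cy = convex⇒inBox-closed convex C⊆V cx cy λ j →
      subst (Between _ _) (sym (lookup-zipWith (pull s) j x y)) (between-pull s _ _)

    extremal-point : ∀ s (is : List (Fin (suc d))) → ∃[ p ] C p × (∀ j → j ∈ is → InFace j s p)
    extremal-point s [] with x , ux , _ ← hit zero s = x , unselected⊆C x ux , λ _ ()
    extremal-point s (i ∷ is)
      with p , cp , p-on ← extremal-point s is
      with a , ua , a-on ← hit i s
      = zipWith (pull s) p a , pull-closed s cp (unselected⊆C a ua) , on
      where
        on : ∀ j → j ∈ i ∷ is → InFace j s (zipWith (pull s) p a)
        on j j∈ = subst (Extreme _ s) (sym (lookup-zipWith (pull s) j p a)) (on′ j∈)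
          where
            on′ : j ∈ i ∷ is → Extreme (lookup n j) s (pull s (lookup p j) (lookup a j))
            on′ (here refl) = extreme-pullʳ s (C⊆V p cp j) a-on
            on′ (there j∈is) = extreme-pullˡ s (proj₁ ua j) (p-on j j∈is)

    everything-in-C : ∀ z → Vert z → C z
    everything-in-C z vz
      with p , cp , p-lo ← extremal-point lo (allFin _)
      with q , cq , q-hi ← extremal-point hi (allFin _)
      = convex⇒inBox-closed convex C⊆V cp cq λ j →
          extremes-span (p-lo j (∈-allFin j)) (q-hi j (∈-allFin j)) (vz j)

  someUnselectedOn⇒notEnded : ∀ {P} → (∀ i s → SomeUnselectedOn P i s) → NotEnded P
  someUnselectedOn⇒notEnded hit z vz = vz , λ C C⊆V convex unselected⊆C →
    everything-in-C hit C⊆V convex unselected⊆C z vz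

  start-notEnded : NotEnded start
  start-notEnded = someUnselectedOn⇒notEnded λ i s → corner s , (corner-vert s , refl) , corner-inFace i s

  unselected? : ∀ P x → Dec (Unselected P x)
  unselected? P x = all? (λ i → lookup x i <? lookup n i) ×-dec (P x Bool.≟ false)

  ∃-unselected? : ∀ P {R : Pt → Set} → (∀ x → Dec (R x)) → Dec (∃[ x ] Unselected P x × R x)
  ∃-unselected? P R? with any? (λ x → unselected? P x ×-dec R? x) (vectorsBelow n)
  ... | yes found = yes (satisfied found)
  ... | no none = no λ (x , ux , rx) → none (lose (∈-vectorsBelow n x (proj₁ ux)) (ux , rx))

  notEnded? : ∀ P → Dec (NotEnded P)
  notEnded? P with everyFace-or-counterexample (λ i s → ∃-unselected? P (inFace? i s))
  ... | inj₁ hit = yes (someUnselectedOn⇒notEnded hit)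
  ... | inj₂ (i , s , none) = no λ notEnded → none (notEnded⇒someUnselectedOn notEnded i s)

-- Grundy values

∈⇒≤sum : ∀ {x xs} → x ∈ xs → x ≤ sum xs
∈⇒≤sum {xs = y ∷ ys} (here refl) = m≤m+n y (sum ys)
∈⇒≤sum {xs = y ∷ ys} (there x∈ys) = ≤-trans (∈⇒≤sum x∈ys) (m≤n+m (sum ys) y)

1+sum∉ : ∀ xs → suc (sum xs) ∉ xs
1+sum∉ xs 1+sum∈xs = <⇒≱ ≤-refl (∈⇒≤sum 1+sum∈xs)

∃-mex : (xs : List ℕ) → ∃[ m ] m ∉ xs × (∀ k → k < m → k ∈ xs)
∃-mex xs
  with i , i∉xs , below ← ¬∀⟶∃¬-smallest (suc (suc (sum xs))) (λ i → toℕ i ∈ xs) (λ i → toℕ i ∈? xs)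
                            (λ all∈ → 1+sum∉ xs (subst (_∈ xs) (toℕ-fromℕ _) (all∈ (fromℕ _))))
  = toℕ i , i∉xs , λ k k<i → subst (_∈ xs) (trans (toℕ-inject _) (toℕ-fromℕ< k<i)) (below (fromℕ< k<i))

module Play {k} (n : Vec ℕ k) where
  open Lattice n

  _≟ᵥ_ : DecidableEquality Pt
  _≟ᵥ_ = ≡-dec _≟_

  select : Pos → Pt → Pos
  select P v w = P w ∨ ⌊ w ≟ᵥ v ⌋

  select-self : ∀ P v → select P v v ≡ true
  select-self P v with v ≟ᵥ v
  ... | yes _ = ∨-zeroʳ (P v)
  ... | no v≢v = contradiction refl v≢v

  select-other : ∀ P {v w} → w ≢ v → select P v w ≡ P w
  select-other P {v} {w} w≢v with w ≟ᵥ v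
  ... | yes w≡v = contradiction w≡v w≢v
  ... | no _ = ∨-identityʳ (P w)

  select-unselected⁻ : ∀ P {v w} → select P v w ≡ false → P w ≡ false × w ≢ v
  select-unselected⁻ P {v} {w} sel≡false with P w | w ≟ᵥ v
  ... | false | no w≢v = refl , w≢v

  move-select : ∀ {P} v → NotEnded P → Unselected P v → Move P (select P v)
  move-select v notEnded (vv , pv) = notEnded , v , vv , pv , λ _ → refl

  move-resp : ∀ {P P′ Q} → P ≗ P′ → Move P Q → Move P′ Q
  move-resp P≗P′ (notEnded , v , vv , pv , Q≗) =
    (λ z vz → proj₁ (notEnded z vz) , λ C C⊆V convex unselected⊆C →
       proj₂ (notEnded z vz) C C⊆V convex λ x (vx , px) → unselected⊆C x (vx , trans (sym (P≗P′ x)) px)) ,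
    v , vv , trans (sym (P≗P′ v)) pv , λ w → trans (Q≗ w) (cong (_∨ _) (P≗P′ w))

  Grundy-resp : ∀ {P P′ g} → P ≗ P′ → Grundy P g → Grundy P′ g
  Grundy-resp P≗P′ (mex options below) =
    mex (λ Q mv → options Q (move-resp (sym ∘ P≗P′) mv))
        (λ k k<g → let Q , mv , grQ = below k k<g in Q , move-resp P≗P′ mv , grQ)

  Grundy-unique : ∀ {P g g′} → Grundy P g → Grundy P g′ → g ≡ g′
  Grundy-unique {g = g} {g′} (mex options below) (mex options′ below′) with <-cmp g g′
  ... | tri≈ _ g≡g′ _ = g≡g′
  ... | tri< g<g′ _ _ = let Q , mv , grQ = below′ g g<g′ ; h , grQ′ , h≢g = options Q mv in
                        contradiction (Grundy-unique grQ′ grQ) h≢g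
  ... | tri> _ _ g′<g = let Q , mv , grQ = below g′ g′<g ; h , grQ′ , h≢g′ = options′ Q mv in
                        contradiction (Grundy-unique grQ′ grQ) h≢g′

  option-Grundy≢ : ∀ {P Q g h} → Grundy P g → Move P Q → Grundy Q h → h ≢ g
  option-Grundy≢ (mex options _) mv grQ with h′ , grQ′ , h′≢g ← options _ mv =
    λ h≡g → h′≢g (trans (Grundy-unique grQ′ grQ) h≡g)

  ended⇒Grundy0 : ∀ {P} → ¬ NotEnded P → Grundy P 0
  ended⇒Grundy0 ended = mex (λ _ mv → contradiction (proj₁ mv) ended) (λ _ ())

module GrundyExistence {d} (n : Vec ℕ (suc d)) (n>0 : ∀ i → 0 < lookup n i) where
  open Lattice n
  open Faces n n>0
  open Play n

  Option : Pos → Set₁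
  Option P = Σ ℕ λ h → Σ Pos λ Q → Move P Q × Grundy Q h

  mex-Grundy : ∀ {P} (options : List (Option P)) →
               (∀ Q → Move P Q → ∃[ h ] Grundy Q h × h ∈ List.map proj₁ options) → ∃ (Grundy P)
  mex-Grundy options covered with g , g∉ , below ← ∃-mex (List.map proj₁ options) =
    g , mex (λ Q mv → let h , grQ , h∈ = covered Q mv in h , grQ , λ h≡g → g∉ (subst (_∈ _) h≡g h∈))
            (λ k k<g → let (_ , Q , mv , grQ) , _ , k≡h = ∈-map⁻ proj₁ (below k k<g) in
                       Q , mv , subst (Grundy Q) (sym k≡h) grQ)

  Covers : List Pt → Pos → Set
  Covers L P = ∀ x → Unselected P x → x ∈ L

  Grundy-exists′ : ∀ L → Acc (_<_ on length) L → ∀ P → Covers L P → ∃ (Grundy P)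
  Grundy-exists′ L (acc smaller) P covers with notEnded? P
  ... | no ended = 0 , ended⇒Grundy0 ended
  ... | yes notEnded = mex-Grundy options covered
    where
      without : Pt → List Pt
      without v = filter (λ w → ¬? (w ≟ᵥ v)) L

      value : ∀ {v} → Unselected P v → ∃ (Grundy (select P v))
      value {v} uv = Grundy-exists′ (without v) (smaller shorter) (select P v) covers′
        where
          shorter : length (without v) < length L
          shorter = filter-notAll _ L (Any.map (λ v≡w w≢v → w≢v (sym v≡w)) (covers v uv))
          covers′ : Covers (without v) (select P v)
          covers′ x (vx , sx) with px , x≢v ← select-unselected⁻ P sx = ∈-filter⁺ _ (covers x (vx , px)) x≢v

      candidates : List Pt
      candidates = filter (unselected? P) L

      option : ∀ {v} → v ∈ candidates → Option P
      option {v} v∈ = let uv = proj₂ (∈-filter⁻ (unselected? P) {xs = L} v∈) in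
        proj₁ (value uv) , select P v , move-select v notEnded uv , proj₂ (value uv)

      options : List (Option P)
      options = mapWith∈ candidates option

      covered : ∀ Q → Move P Q → ∃[ h ] Grundy Q h × h ∈ List.map proj₁ options
      covered Q (_ , v , vv , pv , Q≗) =
        proj₁ (option v∈) , Grundy-resp (sym ∘ Q≗) (proj₂ (proj₂ (proj₂ (option v∈)))) ,
        ∈-map⁺ proj₁ (mapWith∈⁺ option (v , v∈ , refl))
        where v∈ = ∈-filter⁺ (unselected? P) (covers v (vv , pv)) (vv , pv)

  Grundy-exists : ∀ P → ∃ (Grundy P)
  Grundy-exists P = Grundy-exists′ (vectorsBelow n) (On.wellFounded length <-wellFounded _) P
    λ x ux → ∈-vectorsBelow n x (proj₁ ux)

-- The mirror strategy

m+m≡n+n⇒m≡n : ∀ {m n} → m + m ≡ n + n → m ≡ n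
m+m≡n+n⇒m≡n {m} {n} eq with <-cmp m n
... | tri< m<n _ _ = contradiction eq (<⇒≢ (+-mono-< m<n m<n))
... | tri≈ _ m≡n _ = m≡n
... | tri> _ _ n<m = contradiction (sym eq) (<⇒≢ (+-mono-< n<m n<m))

reflect-fixed : ∀ {h a} → a ≤ h + h → (h + h) ∸ a ≡ a → a ≡ h
reflect-fixed {h} {a} a≤2h fixed = m+m≡n+n⇒m≡n (begin
  a + a            ≡⟨ cong (_+ a) fixed ⟨
  (h + h) ∸ a + a  ≡⟨ m∸n+n≡m a≤2h ⟩
  h + h            ∎)
  where open ≡-Reasoning

extreme-reflect : ∀ {m} s {a} → a < m → Extreme m s a → Extreme m (flip s) (pred m ∸ a)
extreme-reflect lo (s≤s _) refl = refl
extreme-reflect hi {a} _ refl = n∸n≡0 a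

extreme-flip-disjoint : ∀ {m} s {a} → 2 ≤ m → Extreme m s a → ¬ Extreme m (flip s) a
extreme-flip-disjoint lo (s≤s ()) refl refl
extreme-flip-disjoint hi (s≤s ()) refl refl

middle-not-extreme : ∀ {h} s → 0 < h → ¬ Extreme (suc (h + h)) s h
middle-not-extreme lo h>0 h≡0 = <⇒≢ h>0 (sym h≡0)
middle-not-extreme {h} hi h>0 eq = <⇒≢ (m<m+n h h>0) (suc-injective eq)

⌊⌋-cong : ∀ {a b} {A : Set a} {B : Set b} → (A → B) → (B → A) → (a? : Dec A) (b? : Dec B) → ⌊ a? ⌋ ≡ ⌊ b? ⌋
⌊⌋-cong f g a? b? = trans (isYes≗does a?) (trans (does-⇔ (mk⇔ f g) a? b?) (sym (isYes≗does b?)))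

module Mirror {d} (n : Vec ℕ (suc (suc d))) (half : Fin (suc (suc d)) → ℕ)
              (n≡ : ∀ i → lookup n i ≡ suc (half i + half i)) (half>0 : ∀ i → 0 < half i) where
  open Lattice n

  n>0 : ∀ i → 0 < lookup n i
  n>0 i = subst (0 <_) (sym (n≡ i)) z<s

  open Faces n n>0
  open Play n
  open GrundyExistence n n>0

  top≡ : ∀ i → pred (lookup n i) ≡ half i + half i
  top≡ i = cong pred (n≡ i)

  mirror : Pt → Pt
  mirror x = tabulate λ i → pred (lookup n i) ∸ lookup x i

  lookup-mirror : ∀ x i → lookup (mirror x) i ≡ pred (lookup n i) ∸ lookup x i
  lookup-mirror x i = lookup∘tabulate (λ j → pred (lookup n j) ∸ lookup x j) i

  centre : Pt
  centre = tabulate half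

  centre-vert : Vert centre
  centre-vert i = subst₂ _<_ (sym (lookup∘tabulate half i)) (sym (n≡ i)) (s≤s (m≤m+n (half i) (half i)))

  mirror-vert : ∀ x → Vert x → Vert (mirror x)
  mirror-vert x vx i = subst (_< lookup n i) (sym (lookup-mirror x i))
    (≤-<-trans (m∸n≤m _ (lookup x i)) (subst (pred (lookup n i) <_) (suc-pred-n i) ≤-refl))

  mirror-involutive : ∀ x → Vert x → mirror (mirror x) ≡ x
  mirror-involutive x vx = lookup-ext _ x λ i → begin
    lookup (mirror (mirror x)) i                    ≡⟨ lookup-mirror (mirror x) i ⟩
    pred (lookup n i) ∸ lookup (mirror x) i         ≡⟨ cong (pred (lookup n i) ∸_) (lookup-mirror x i) ⟩
    pred (lookup n i) ∸ (pred (lookup n i) ∸ lookup x i) ≡⟨ m∸[m∸n]≡n (<⇒≤pred (vx i)) ⟩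
    lookup x i                                      ∎
    where open ≡-Reasoning

  mirror-injective : ∀ x y → Vert x → Vert y → mirror x ≡ mirror y → x ≡ y
  mirror-injective x y vx vy eq = trans (sym (mirror-involutive x vx)) (trans (cong mirror eq) (mirror-involutive y vy))

  mirror-centre : mirror centre ≡ centre
  mirror-centre = lookup-ext _ _ λ i → begin
    lookup (mirror centre) i                  ≡⟨ lookup-mirror centre i ⟩
    pred (lookup n i) ∸ lookup centre i       ≡⟨ cong₂ _∸_ (top≡ i) (lookup∘tabulate half i) ⟩
    (half i + half i) ∸ half i                ≡⟨ m+n∸m≡n (half i) (half i) ⟩
    half i                                    ≡⟨ lookup∘tabulate half i ⟨
    lookup centre i                           ∎
    where open ≡-Reasoning

  mirror-fixed⇒centre : ∀ x → Vert x → mirror x ≡ x → x ≡ centre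
  mirror-fixed⇒centre x vx fixed = lookup-ext x centre λ i →
    trans (reflect-fixed (subst (lookup x i ≤_) (top≡ i) (<⇒≤pred (vx i))) (fixedᵢ i)) (sym (lookup∘tabulate half i))
    where
      fixedᵢ : ∀ i → (half i + half i) ∸ lookup x i ≡ lookup x i
      fixedᵢ i = begin
        (half i + half i) ∸ lookup x i   ≡⟨ cong (_∸ lookup x i) (top≡ i) ⟨
        pred (lookup n i) ∸ lookup x i   ≡⟨ lookup-mirror x i ⟨
        lookup (mirror x) i              ≡⟨ cong (λ y → lookup y i) fixed ⟩
        lookup x i                       ∎
        where open ≡-Reasoning

  mirror-inFace : ∀ x {i s} → Vert x → InFace i s x → InFace i (flip s) (mirror x)
  mirror-inFace x {i} {s} vx fx =
    subst (Extreme (lookup n i) (flip s)) (sym (lookup-mirror x i)) (extreme-reflect s (vx i) fx)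

  inFace-flip-disjoint : ∀ {x i s} → InFace i s x → ¬ InFace i (flip s) x
  inFace-flip-disjoint {i = i} {s} =
    extreme-flip-disjoint s (subst (2 ≤_) (sym (n≡ i)) (s≤s (≤-trans (half>0 i) (m≤m+n _ _))))

  centre-not-inFace : ∀ {i s} → ¬ InFace i s centre
  centre-not-inFace {i} {s} f = middle-not-extreme s (half>0 i)
    (subst₂ (λ m a → Extreme m s a) (n≡ i) (lookup∘tabulate half i) f)

  TwoUnselectedOn : Pos → Fin (suc (suc d)) → Side → Set
  TwoUnselectedOn P i s = ∃[ a ] Unselected P a × InFace i s a × ∃[ b ] Unselected P b × InFace i s b × a ≢ b

  twoUnselectedOn? : ∀ P i s → Dec (TwoUnselectedOn P i s)
  twoUnselectedOn? P i s =
    ∃-unselected? P λ a → inFace? i s a ×-dec ∃-unselected? P λ b → inFace? i s b ×-dec ¬? (a ≟ᵥ b)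

  one-avoiding : ∀ {P i s} → TwoUnselectedOn P i s → ∀ t → ∃[ w ] (Unselected P w × InFace i s w) × w ≢ t
  one-avoiding (a , ua , fa , b , ub , fb , a≢b) t with a ≟ᵥ t
  ... | yes refl = b , (ub , fb) , λ b≡a → a≢b (sym b≡a)
  ... | no a≢t = a , (ua , fa) , a≢t

  select-keeps-unselected : ∀ {P Q v w} → Q ≗ select P v → Unselected P w → w ≢ v → Unselected Q w
  select-keeps-unselected {P} Q≗ (vw , pw) w≢v = vw , trans (Q≗ _) (trans (select-other P w≢v) pw)

  select-notEnded : ∀ {P Q v} → (∀ i s → TwoUnselectedOn P i s) → Q ≗ select P v → NotEnded Q
  select-notEnded {v = v} two Q≗ = someUnselectedOn⇒notEnded λ i s →
    let w , (uw , fw) , w≢v = one-avoiding (two i s) v in w , select-keeps-unselected Q≗ uw w≢v , fw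

  last-on-face : ∀ {P Q v i s} → (∀ i s → TwoUnselectedOn P i s) → Q ≗ select P v →
                 ¬ TwoUnselectedOn Q i s → ∃[ R ] Move Q R × ¬ NotEnded R
  last-on-face {Q = Q} {v} {i} {s} two Q≗ ¬two
    with w , (uw , fw) , w≢v ← one-avoiding (two i s) v
    = select Q w , move-select w (select-notEnded two Q≗) uwQ , ended
    where
      uwQ = select-keeps-unselected Q≗ uw w≢v
      ended : ¬ NotEnded (select Q w)
      ended notEnded
        with x , (vx , rx) , fx ← notEnded⇒someUnselectedOn notEnded i s
        with qx , x≢w ← select-unselected⁻ Q rx
        = ¬two (x , (vx , qx) , fx , w , uwQ , fw , x≢w)

  Symmetric : Pos → Set
  Symmetric P = ∀ w → Vert w → P (mirror w) ≡ P w

  record Balanced (P : Pos) : Set where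
    field
      symmetric : Symmetric P
      centre-selected : P centre ≡ true
      roomy : ∀ i s → TwoUnselectedOn P i s

  module Reply {P Q v} (balanced : Balanced P) (vv : Vert v) (pv : P v ≡ false) (Q≗ : Q ≗ select P v)
               (roomyQ : ∀ i s → TwoUnselectedOn Q i s) where
    open Balanced balanced

    u : Pt
    u = mirror v

    R : Pos
    R = select Q u

    u≢v : u ≢ v
    u≢v fixed with () ← trans (sym centre-selected) (trans (cong P (sym (mirror-fixed⇒centre v vv fixed))) pv)

    keep : ∀ {w} → Unselected Q w → w ≢ u → Unselected R w
    keep = select-keeps-unselected {P = Q} (λ _ → refl)

    reply : Move Q R
    reply = move-select u (someUnselectedOn⇒notEnded λ i s → let a , ua , fa , _ = roomyQ i s in a , ua , fa)
                          (select-keeps-unselected Q≗ (mirror-vert v vv , trans (symmetric v vv) pv) u≢v)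

    symmetricR : Symmetric R
    symmetricR w vw = begin
      Q (mirror w) ∨ ⌊ mirror w ≟ᵥ u ⌋
        ≡⟨ cong₂ _∨_ (Q≗ (mirror w)) (⌊⌋-cong (mirror-injective w v vw vv) (cong mirror) _ _) ⟩
      (P (mirror w) ∨ ⌊ mirror w ≟ᵥ v ⌋) ∨ ⌊ w ≟ᵥ v ⌋
        ≡⟨ cong₂ (λ p q → (p ∨ q) ∨ ⌊ w ≟ᵥ v ⌋) (symmetric w vw) (⌊⌋-cong mirror-w≡v⇒w≡u w≡u⇒mirror-w≡v _ _) ⟩
      (P w ∨ ⌊ w ≟ᵥ u ⌋) ∨ ⌊ w ≟ᵥ v ⌋
        ≡⟨ xy∙z≈xz∙y (P w) _ _ ⟩
      (P w ∨ ⌊ w ≟ᵥ v ⌋) ∨ ⌊ w ≟ᵥ u ⌋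
        ≡⟨ cong (_∨ ⌊ w ≟ᵥ u ⌋) (Q≗ w) ⟨
      Q w ∨ ⌊ w ≟ᵥ u ⌋
        ∎
      where
        open ≡-Reasoning
        mirror-w≡v⇒w≡u : mirror w ≡ v → w ≡ u
        mirror-w≡v⇒w≡u eq = trans (sym (mirror-involutive w vw)) (cong mirror eq)
        w≡u⇒mirror-w≡v : w ≡ u → mirror w ≡ v
        w≡u⇒mirror-w≡v eq = trans (cong mirror eq) (mirror-involutive v vv)

    centre-selectedR : R centre ≡ true
    centre-selectedR = cong (_∨ ⌊ centre ≟ᵥ u ⌋) (trans (Q≗ centre) (cong (_∨ ⌊ centre ≟ᵥ v ⌋) centre-selected))

    -- If the reply u was one of the two unselected vertices on a face, the mirror image of an
    -- unselected vertex on the opposite face takes its place.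
    partner : ∀ {i s b} → InFace i s u → Unselected Q b → InFace i s b → b ≢ u → TwoUnselectedOn R i s
    partner {i} {s} {b} fu ub fb b≢u
      with c , (uc , fc) , c≢mirror-b ← one-avoiding (roomyQ i (flip s)) (mirror b)
      = mirror c , keep uc′ c′≢u , fc′ , b , keep ub b≢u , fb , c′≢b
      where
        vc = proj₁ uc
        pc = proj₁ (select-unselected⁻ P (trans (sym (Q≗ c)) (proj₂ uc)))
        c≢v = proj₂ (select-unselected⁻ P (trans (sym (Q≗ c)) (proj₂ uc)))
        fc′ : InFace i s (mirror c)
        fc′ = subst (λ t → InFace i t (mirror c)) (flip-involutive s) (mirror-inFace c vc fc)
        fv : InFace i (flip s) v
        fv = subst (InFace i (flip s)) (mirror-involutive v vv) (mirror-inFace u (mirror-vert v vv) fu)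
        c′≢v : mirror c ≢ v
        c′≢v eq = inFace-flip-disjoint {v} (subst (InFace i s) eq fc′) fv
        uc′ : Unselected Q (mirror c)
        uc′ = select-keeps-unselected Q≗ (mirror-vert c vc , trans (symmetric c vc) pc) c′≢v
        c′≢u : mirror c ≢ u
        c′≢u = c≢v ∘ mirror-injective c v vc vv
        c′≢b : mirror c ≢ b
        c′≢b eq = c≢mirror-b (trans (sym (mirror-involutive c vc)) (cong mirror eq))

    roomyR : ∀ i s → TwoUnselectedOn R i s
    roomyR i s with a , ua , fa , b , ub , fb , a≢b ← roomyQ i s with a ≟ᵥ u | b ≟ᵥ u
    ... | yes refl | _ = partner fa ub fb (a≢b ∘ sym)
    ... | no a≢u | yes refl = partner fb ua fa a≢u
    ... | no a≢u | no b≢u = a , keep ua a≢u , fa , b , keep ub b≢u , fb , a≢b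

    balancedR : Balanced R
    balancedR = record { symmetric = symmetricR ; centre-selected = centre-selectedR ; roomy = roomyR }

  response : ∀ {P Q} → Balanced P → Move P Q → ∃[ R ] Move Q R × (¬ NotEnded R ⊎ Balanced R)
  response balanced (_ , v , vv , pv , Q≗) with everyFace-or-counterexample (twoUnselectedOn? _)
  ... | inj₁ roomyQ = let open Reply balanced vv pv Q≗ roomyQ in R , reply , inj₂ balancedR
  ... | inj₂ (_ , _ , ¬two) = let R , move , ended = last-on-face (Balanced.roomy balanced) Q≗ ¬two in
                              R , move , inj₁ ended

  balanced⇒Grundy0 : ∀ {P g} → Grundy P g → Balanced P → g ≡ 0
  balanced⇒Grundy0 {g = zero} _ _ = refl
  balanced⇒Grundy0 {g = suc g} (mex _ below) balanced
    with Q , move , mex options _ ← below 0 z<s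
    with R , moveR , ended-or-balanced ← response balanced move
    with h , grundyR , h≢0 ← options R moveR
    = contradiction ([ (λ ended → Grundy-unique grundyR (ended⇒Grundy0 ended))
                     , balanced⇒Grundy0 grundyR ] ended-or-balanced) h≢0

  another : ∀ (i : Fin (suc (suc d))) → ∃[ j ] j ≢ i
  another zero = suc zero , λ ()
  another (suc i) = zero , λ ()

  corners-differ : ∀ s j → lookup (corner s) j ≢ lookup (corner (flip s)) j
  corners-differ s j eq = inFace-flip-disjoint {corner s} (corner-inFace j s)
    (subst (Extreme (lookup n j) (flip s)) (sym eq) (corner-inFace j (flip s)))

  centre-selected-balanced : Balanced (select start centre)
  centre-selected-balanced = record
    { symmetric = λ w vw → ⌊⌋-cong (λ eq → trans (sym (mirror-involutive w vw)) (trans (cong mirror eq) mirror-centre))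
                                    (λ eq → trans (cong mirror eq) mirror-centre) _ _
    ; centre-selected = select-self start centre
    ; roomy = roomy
    }
    where
      off-centre : ∀ {x i s} → Vert x → InFace i s x → Unselected (select start centre) x
      off-centre {x} vx fx = vx , select-other start λ x≡centre → centre-not-inFace (subst (InFace _ _) x≡centre fx)
      roomy : ∀ i s → TwoUnselectedOn (select start centre) i s
      roomy i s = a , off-centre (corner-vert s) (corner-inFace i s) , corner-inFace i s ,
                  b , off-centre vb fb , fb , a≢b
        where
          j = proj₁ (another i)
          a = corner s
          b = corner s [ j ]≔ lookup (corner (flip s)) j
          vb : Vert b
          vb k with k Finₚ.≟ j
          ... | yes refl = subst (_< lookup n k) (sym (lookup∘update k a _)) (corner-vert (flip s) k)
          ... | no k≢j = subst (_< lookup n k) (sym (lookup∘update′ k≢j a _)) (corner-vert s k)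
          fb : InFace i s b
          fb = subst (Extreme (lookup n i) s) (sym (lookup∘update′ (proj₂ (another i) ∘ sym) a _)) (corner-inFace i s)
          a≢b : a ≢ b
          a≢b eq = corners-differ s j (trans (cong (λ x → lookup x j) eq) (lookup∘update j a _))

  centre-first-move : ∃[ Q ] Move start Q × Grundy Q 0
  centre-first-move with g , grundy ← Grundy-exists (select start centre) =
    select start centre , move-select centre start-notEnded (centre-vert , refl) ,
    subst (Grundy _) (balanced⇒Grundy0 grundy centre-selected-balanced) grundy

-- The first move

module Path (m : ℕ) (m>0 : 0 < m) where
  open Lattice (m ∷ [])

  m∷[]>0 : ∀ i → 0 < lookup (m ∷ []) i
  m∷[]>0 zero = m>0

  open Faces (m ∷ []) m∷[]>0
  open Play (m ∷ [])

  endpoint-ends : ¬ NotEnded (select start (corner lo))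
  endpoint-ends notEnded with (_ ∷ []) , (_ , selected≡false) , refl ← notEnded⇒someUnselectedOn notEnded zero lo
    = contradiction (trans (sym (select-self start (corner lo))) selected≡false) λ ()

  endpoint-first-move : ∃[ Q ] Move start Q × Grundy Q 0
  endpoint-first-move = select start (corner lo) , move-select (corner lo) start-notEnded (corner-vert lo , refl) ,
                           ended⇒Grundy0 endpoint-ends

odd-factorˡ : ∀ a b → (a * b) % 2 ≡ 1 → a % 2 ≡ 1
odd-factorˡ a b odd with a % 2 | m%n<n a 2 | trans (sym (%-distribˡ-* a b 2)) odd
... | 0 | _ | ()
... | 1 | _ | _ = refl
... | suc (suc _) | s≤s (s≤s ()) | _

odd-factorʳ : ∀ a b → (a * b) % 2 ≡ 1 → b % 2 ≡ 1
odd-factorʳ a b odd = odd-factorˡ b a (subst (λ t → t % 2 ≡ 1) (*-comm a b) odd)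

odd⇒≡1+h+h : ∀ a → a % 2 ≡ 1 → ∃[ h ] a ≡ suc (h + h)
odd⇒≡1+h+h a odd = a / 2 , (begin
  a                   ≡⟨ m≡m%n+[m/n]*n a 2 ⟩
  a % 2 + a / 2 * 2   ≡⟨ cong₂ _+_ odd (*-comm (a / 2) 2) ⟩
  suc (2 * (a / 2))   ≡⟨ cong (λ t → suc (a / 2 + t)) (+-identityʳ (a / 2)) ⟩
  suc (a / 2 + a / 2) ∎)
  where open ≡-Reasoning

prodV-odd⇒odd : ∀ {k} (ns : Vec ℕ k) → prodV ns % 2 ≡ 1 → ∀ i → ∃[ h ] lookup ns i ≡ suc (h + h)
prodV-odd⇒odd (m ∷ ns) odd zero = odd⇒≡1+h+h m (odd-factorˡ m (prodV ns) odd)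
prodV-odd⇒odd (m ∷ ns) odd (suc i) = prodV-odd⇒odd ns (odd-factorʳ m (prodV ns) odd) i

2≤1+h+h⇒0<h : ∀ {h} → 2 ≤ suc (h + h) → 0 < h
2≤1+h+h⇒0<h {zero} (s≤s ())
2≤1+h+h⇒0<h {suc h} _ = z<s

winning-first-move : ∀ d (n : Vec ℕ (suc d)) → (∀ i → 2 ≤ lookup n i) → (∀ i → ∃[ h ] lookup n i ≡ suc (h + h)) →
                     ∃[ Q ] Lattice.Move n (Lattice.start n) Q × Lattice.Grundy n Q 0
winning-first-move zero (m ∷ []) 2≤n _ = Path.endpoint-first-move m (≤-trans z<s (2≤n zero))
winning-first-move (suc d) n 2≤n odd = Mirror.centre-first-move n (proj₁ ∘ odd) (proj₂ ∘ odd) half>0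
  where
    half>0 : ∀ i → 0 < proj₁ (odd i)
    half>0 i = 2≤1+h+h⇒0<h (subst (2 ≤_) (proj₂ (odd i)) (2≤n i))

mainTheorem5 : (d : ℕ) (n : Vec ℕ (suc d)) →
    (∀ i → 2 Data.Nat.≤ lookup n i) →
    (∀ i j → i Data.Fin.≤ j → lookup n i Data.Nat.≤ lookup n j) →
    3 Data.Nat.≤ lookup n (fromℕ d) →
    prodV n % 2 ≡ 1 →
    Σ ℕ λ g → Lattice.NimValue n g × g ≢ 0
mainTheorem5 d n 2≤n _ _ odd
  with g , grundy ← GrundyExistence.Grundy-exists n (λ i → ≤-trans z<s (2≤n i)) (Lattice.start n)
  with Q , move , grundyQ ← winning-first-move d n 2≤n (prodV-odd⇒odd n odd)
  = g , grundy , λ g≡0 → Play.option-Grundy≢ n grundy move grundyQ (sym g≡0)
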